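{- Let $K$ be a field, let $A\in K[X]$ be monic of degree $2$, and let $R(X)=v(X-w)$ with $v,w\in K$, $v\neq 0$. Suppose that for the integers $h$ under consideration we are given $e_h\in K$, polynomials $Q_h(X)=v_h(X-w_h)$ with $v_h,w_h\in K$ and $v_h\neq 0$, and polynomials $a_h\in K[X]$, such that for all such $h$ $$e_h+e_{h+1}+A=a_hQ_h\qquad\text{and}\qquad -Q_hQ_{h+1}=-R+e_{h+1}(A+e_{h+1}).$$ Then for every $h$ such that these relations hold at indices $h-1$ and $h$, $$e_{h-1}\,e_h^2\,e_{h+1}=v^2\bigl(e_h+A(w)\bigr).$$
   Context: These relations are exactly the data of the continued fraction expansion, line by line $\frac{Z+P_h}{Q_h}=a_h-\frac{\bar Z+P_{h+1}}{Q_{h+1}}$, of $(Z+P_0)/Q_0$ where $Z$ satisfies $Z^2-AZ-R=0$ (so $2Z-A$ is a square root of the monic quartic $D=A^2+4R$), in the genus-one case where all $P_h=e_h$ are constants and all $Q_h$ have degree exactly $1$ (all partial quotients $a_h$ of degree $1$). -}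

module Defs where

open import Level using (_⊔_)
open import Algebra.Bundles using (CommutativeRing)
open import Data.List using (List; []; _∷_)
open import Data.Nat using (ℕ; zero; suc)
open import Data.Product using (Σ; _×_)
open import Relation.Nullary using (¬_)

record IsFieldCR {c ℓ} (K : CommutativeRing c ℓ) : Set (c ⊔ ℓ) where
  open CommutativeRing K
  field
    0≉1     : ¬ (0# ≈ 1#)
    inverse : ∀ x → ¬ (x ≈ 0#) → Σ Carrier λ y → (x * y) ≈ 1#

-- Univariate polynomials K[X] as coefficient lists (constant term first),
-- with equality = equality of all coefficients (trailing zeros irrelevant).
module Poly {c ℓ} (K : CommutativeRing c ℓ) where
  open CommutativeRing K

  Pol : Set c
  Pol = List Carrier

  coeff : Pol → ℕ → Carrier
  coeff []      _       = 0#
  coeff (a ∷ p) zero    = a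
  coeff (a ∷ p) (suc n) = coeff p n

  infix 4 _≈ₚ_
  _≈ₚ_ : Pol → Pol → Set ℓ
  p ≈ₚ q = ∀ n → coeff p n ≈ coeff q n

  infixl 6 _+ₚ_
  _+ₚ_ : Pol → Pol → Pol
  []      +ₚ q       = q
  (a ∷ p) +ₚ []      = a ∷ p
  (a ∷ p) +ₚ (b ∷ q) = (a + b) ∷ (p +ₚ q)

  scale : Carrier → Pol → Pol
  scale c []      = []
  scale c (a ∷ p) = (c * a) ∷ scale c p

  infixl 7 _*ₚ_
  _*ₚ_ : Pol → Pol → Pol
  []      *ₚ q = []
  (a ∷ p) *ₚ q = scale a q +ₚ (0# ∷ (p *ₚ q))

  -ₚ_ : Pol → Pol
  -ₚ p = scale (- 1#) p

  C : Carrier → Pol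
  C a = a ∷ []

  eval : Pol → Carrier → Carrier
  eval []      x = 0#
  eval (a ∷ p) x = a + x * eval p x

  lin : Carrier → Carrier → Pol
  lin v w = (- (v * w)) ∷ v ∷ []

  monicQuad : Carrier → Carrier → Pol
  monicQuad a₀ a₁ = a₀ ∷ a₁ ∷ 1# ∷ []

-- Evaluate the norm relation  -Q_{h-1} Q_h = -R + e_h (A + e_h)  at the roots of Q_{h-1},
-- Q_h and R. At the root w_{h-1} of Q_{h-1} the sum relation gives A(w_{h-1}) + e_h = -e_{h-1},
-- hence R(w_{h-1}) = -e_{h-1} e_h; likewise R(w_h) = -e_h e_{h+1}. At the root w of R it gives
-- e_h (A(w) + e_h) = -Q_{h-1}(w) Q_h(w). Since v Q_j(w) = -v_j R(w_j), and -v_{h-1} v_h = e_h by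
-- comparing X² coefficients, multiplying by v² turns this into
-- e_h · v² (e_h + A(w)) = e_h · e_{h-1} e_h² e_{h+1}, and e_h = -v_{h-1} v_h ≠ 0 cancels.
{-# OPTIONS --safe #-}
module Submission where

open import Defs
open import Algebra.Bundles using (CommutativeRing)
open import Data.Integer as Z using (ℤ)
open import Relation.Nullary using (¬_)
open import Relation.Binary.PropositionalEquality using (_≡_)
open import Data.Sum using (_⊎_)
open import Data.Product using (_×_)

open import Data.Integer.Properties using (suc-pred)
open import Data.List using ([]; _∷_)
open import Data.Nat using (suc)
open import Data.Product using (_,_; proj₁; proj₂)
open import Data.Sum using (inj₁; inj₂)
open import Function using (_∘_)
import Relation.Binary.PropositionalEquality as ≡
import Algebra.Properties.CommutativeSemigroup as CommutativeSemigroupProperties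
import Algebra.Properties.Ring as RingProperties

module Evaluation {c ℓ} (K : CommutativeRing c ℓ) where
  open CommutativeRing K
  open Poly K
  open RingProperties ring using (-1*x≈-x; -‿distribʳ-*; ⁻¹-anti-homo‿-)
  open CommutativeSemigroupProperties +-commutativeSemigroup using (interchange)
  open CommutativeSemigroupProperties *-commutativeSemigroup using (x∙yz≈y∙xz)
  open import Relation.Binary.Reasoning.Setoid setoid

  eval-vanishing : ∀ p x → (∀ n → coeff p n ≈ 0#) → eval p x ≈ 0#
  eval-vanishing []      x p≈0 = refl
  eval-vanishing (a ∷ p) x p≈0 = begin
    a + x * eval p x  ≈⟨ +-cong (p≈0 0) (*-congˡ (eval-vanishing p x (p≈0 ∘ suc))) ⟩
    0# + x * 0#       ≈⟨ +-identityˡ _ ⟩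
    x * 0#            ≈⟨ zeroʳ x ⟩
    0#                ∎

  eval-cong : ∀ p q x → p ≈ₚ q → eval p x ≈ eval q x
  eval-cong []      []      x p≈q = refl
  eval-cong []      (b ∷ q) x p≈q = sym (eval-vanishing (b ∷ q) x (sym ∘ p≈q))
  eval-cong (a ∷ p) []      x p≈q = eval-vanishing (a ∷ p) x p≈q
  eval-cong (a ∷ p) (b ∷ q) x p≈q =
    +-cong (p≈q 0) (*-congˡ (eval-cong p q x (p≈q ∘ suc)))

  eval-+ : ∀ p q x → eval (p +ₚ q) x ≈ eval p x + eval q x
  eval-+ []      q       x = sym (+-identityˡ _)
  eval-+ (a ∷ p) []      x = sym (+-identityʳ _)
  eval-+ (a ∷ p) (b ∷ q) x = begin
    (a + b) + x * eval (p +ₚ q) x            ≈⟨ +-congˡ (*-congˡ (eval-+ p q x)) ⟩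
    (a + b) + x * (eval p x + eval q x)      ≈⟨ +-congˡ (distribˡ x _ _) ⟩
    (a + b) + (x * eval p x + x * eval q x)  ≈⟨ interchange a b _ _ ⟩
    (a + x * eval p x) + (b + x * eval q x)  ∎

  eval-scale : ∀ k p x → eval (scale k p) x ≈ k * eval p x
  eval-scale k []      x = sym (zeroʳ k)
  eval-scale k (a ∷ p) x = begin
    k * a + x * eval (scale k p) x  ≈⟨ +-congˡ (*-congˡ (eval-scale k p x)) ⟩
    k * a + x * (k * eval p x)      ≈⟨ +-congˡ (x∙yz≈y∙xz x k _) ⟩
    k * a + k * (x * eval p x)      ≈⟨ distribˡ k a _ ⟨
    k * (a + x * eval p x)          ∎

  eval-* : ∀ p q x → eval (p *ₚ q) x ≈ eval p x * eval q x
  eval-* []      q x = sym (zeroˡ _)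
  eval-* (a ∷ p) q x = begin
    eval (scale a q +ₚ (0# ∷ p *ₚ q)) x               ≈⟨ eval-+ (scale a q) (0# ∷ p *ₚ q) x ⟩
    eval (scale a q) x + (0# + x * eval (p *ₚ q) x)  ≈⟨ +-cong (eval-scale a q x) (+-identityˡ _) ⟩
    a * eval q x + x * eval (p *ₚ q) x               ≈⟨ +-congˡ (*-congˡ (eval-* p q x)) ⟩
    a * eval q x + x * (eval p x * eval q x)         ≈⟨ +-congˡ (*-assoc x _ _) ⟨
    a * eval q x + (x * eval p x) * eval q x         ≈⟨ distribʳ (eval q x) a _ ⟨
    (a + x * eval p x) * eval q x                    ∎

  eval-neg : ∀ p x → eval (-ₚ p) x ≈ - eval p x
  eval-neg p x = trans (eval-scale (- 1#) p x) (-1*x≈-x _)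

  eval-C : ∀ a x → eval (C a) x ≈ a
  eval-C a x = trans (+-congˡ (zeroʳ x)) (+-identityʳ a)

  eval-lin : ∀ v w x → eval (lin v w) x ≈ v * (x - w)
  eval-lin v w x = begin
    - (v * w) + x * eval (C v) x  ≈⟨ +-congˡ (*-congˡ (eval-C v x)) ⟩
    - (v * w) + x * v             ≈⟨ +-comm _ _ ⟩
    x * v + - (v * w)             ≈⟨ +-cong (*-comm x v) (-‿distribʳ-* v w) ⟩
    v * x + v * - w               ≈⟨ distribˡ v x (- w) ⟨
    v * (x - w)                   ∎

  lin-root : ∀ v w → eval (lin v w) w ≈ 0#
  lin-root v w = begin
    eval (lin v w) w  ≈⟨ eval-lin v w w ⟩
    v * (w - w)       ≈⟨ *-congˡ (-‿inverseʳ w) ⟩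
    v * 0#            ≈⟨ zeroʳ v ⟩
    0#                ∎

  lin-swap : ∀ v w V W → v * eval (lin V W) w ≈ - (V * eval (lin v w) W)
  lin-swap v w V W = begin
    v * eval (lin V W) w   ≈⟨ *-congˡ (eval-lin V W w) ⟩
    v * (V * (w - W))      ≈⟨ x∙yz≈y∙xz v V _ ⟩
    V * (v * (w - W))      ≈⟨ *-congˡ (*-congˡ (⁻¹-anti-homo‿- W w)) ⟨
    V * (v * - (W - w))    ≈⟨ *-congˡ (-‿distribʳ-* v _) ⟨
    V * - (v * (W - w))    ≈⟨ -‿distribʳ-* V _ ⟨
    - (V * (v * (W - w)))  ≈⟨ -‿cong (*-congˡ (eval-lin v w W)) ⟨
    - (V * eval (lin v w) W) ∎

  vanishes-at-root-of-factor : ∀ p q V W → p ≈ₚ q *ₚ lin V W → eval p W ≈ 0#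
  vanishes-at-root-of-factor p q V W p≈qQ = begin
    eval p W                     ≈⟨ eval-cong p (q *ₚ lin V W) W p≈qQ ⟩
    eval (q *ₚ lin V W) W        ≈⟨ eval-* q (lin V W) W ⟩
    eval q W * eval (lin V W) W  ≈⟨ *-congˡ (lin-root V W) ⟩
    eval q W * 0#                ≈⟨ zeroʳ _ ⟩
    0#                           ∎

module Recurrence {c ℓ} (K : CommutativeRing c ℓ) (A : Poly.Pol K) (v w : CommutativeRing.Carrier K) where
  open CommutativeRing K
  open Poly K
  open Evaluation K
  open RingProperties ring
    using (-‿distribˡ-*; -‿distribʳ-*; -‿involutive; -0#≈0#; +-inverseʳ-unique)
  open CommutativeSemigroupProperties *-commutativeSemigroup
    using (interchange; x∙yz≈y∙xz; x∙yz≈yx∙z)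
  open import Relation.Binary.Reasoning.Setoid setoid

  R : Pol
  R = lin v w

  record SumRelation (e e′ : Carrier) (Q a : Pol) : Set ℓ where
    constructor sum-relation
    field sum-relation-holds : C e +ₚ C e′ +ₚ A ≈ₚ a *ₚ Q

  -- The right-hand side is the norm (Z + e)(Z̄ + e) of Z + e, where Z² - A Z - R = 0.
  record NormRelation (Q Q′ : Pol) (e : Carrier) : Set ℓ where
    constructor norm-relation
    field norm-relation-holds : -ₚ (Q *ₚ Q′) ≈ₚ (-ₚ R) +ₚ C e *ₚ (A +ₚ C e)

  sum-at-root : ∀ {e e′ V W a} → SumRelation e e′ (lin V W) a → e + e′ + eval A W ≈ 0#
  sum-at-root {e} {e′} {V} {W} {a} (sum-relation rel) = begin
    e + e′ + eval A W                ≈⟨ +-congʳ (eval-C (e + e′) W) ⟨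
    eval (C e +ₚ C e′) W + eval A W  ≈⟨ eval-+ (C e +ₚ C e′) A W ⟨
    eval (C e +ₚ C e′ +ₚ A) W        ≈⟨ vanishes-at-root-of-factor (C e +ₚ C e′ +ₚ A) a V W rel ⟩
    0#                               ∎

  norm-eval : ∀ {Q Q′ e} → NormRelation Q Q′ e → ∀ x →
    - (eval Q x * eval Q′ x) ≈ - eval R x + e * (eval A x + e)
  norm-eval {Q} {Q′} {e} (norm-relation rel) x = begin
    - (eval Q x * eval Q′ x)                       ≈⟨ -‿cong (eval-* Q Q′ x) ⟨
    - eval (Q *ₚ Q′) x                             ≈⟨ eval-neg (Q *ₚ Q′) x ⟨
    eval (-ₚ (Q *ₚ Q′)) x                          ≈⟨ eval-cong (-ₚ (Q *ₚ Q′)) ((-ₚ R) +ₚ C e *ₚ (A +ₚ C e)) x rel ⟩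
    eval ((-ₚ R) +ₚ C e *ₚ (A +ₚ C e)) x           ≈⟨ eval-+ (-ₚ R) (C e *ₚ (A +ₚ C e)) x ⟩
    eval (-ₚ R) x + eval (C e *ₚ (A +ₚ C e)) x     ≈⟨ +-cong (eval-neg R x) (eval-* (C e) (A +ₚ C e) x) ⟩
    - eval R x + eval (C e) x * eval (A +ₚ C e) x  ≈⟨ +-congˡ (*-cong (eval-C e x) (eval-+ A (C e) x)) ⟩
    - eval R x + e * (eval A x + eval (C e) x)     ≈⟨ +-congˡ (*-congˡ (+-congˡ (eval-C e x))) ⟩
    - eval R x + e * (eval A x + e)                ∎

  norm-where-product-vanishes : ∀ {Q Q′ e x} → NormRelation Q Q′ e →
    eval Q x * eval Q′ x ≈ 0# → eval R x ≈ e * (eval A x + e)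
  norm-where-product-vanishes {Q} {Q′} {e} {x} rel QQ′≈0 =
    sym (trans (+-inverseʳ-unique (- eval R x) _ -R+N≈0) (-‿involutive _))
    where
    -R+N≈0 : - eval R x + e * (eval A x + e) ≈ 0#
    -R+N≈0 = begin
      - eval R x + e * (eval A x + e)  ≈⟨ norm-eval rel x ⟨
      - (eval Q x * eval Q′ x)         ≈⟨ -‿cong QQ′≈0 ⟩
      - 0#                             ≈⟨ -0#≈0# ⟩
      0#                               ∎

  norm-at-root-of-R : ∀ {Q Q′ e} → NormRelation Q Q′ e →
    - (eval Q w * eval Q′ w) ≈ e * (eval A w + e)
  norm-at-root-of-R {Q} {Q′} {e} rel = begin
    - (eval Q w * eval Q′ w)         ≈⟨ norm-eval rel w ⟩
    - eval R w + e * (eval A w + e)  ≈⟨ +-congʳ (trans (-‿cong (lin-root v w)) -0#≈0#) ⟩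
    0# + e * (eval A w + e)          ≈⟨ +-identityˡ _ ⟩
    e * (eval A w + e)               ∎

  e-relation-up-to-e₁ : ∀ {e₀ e₁ e₂ V₀ W₀ V₁ W₁ a a′} →
    SumRelation e₀ e₁ (lin V₀ W₀) a → SumRelation e₁ e₂ (lin V₁ W₁) a′ →
    NormRelation (lin V₀ W₀) (lin V₁ W₁) e₁ → - (V₀ * V₁) ≈ e₁ →
    e₁ * (e₀ * (e₁ * e₁) * e₂) ≈ e₁ * ((v * v) * (e₁ + eval A w))
  e-relation-up-to-e₁ {e₀} {e₁} {e₂} {V₀} {W₀} {V₁} {W₁} sum₀ sum₁ norm leading = sym (begin
    e₁ * (v * v * (e₁ + α w))             ≈⟨ x∙yz≈y∙xz e₁ _ _ ⟩
    v * v * (e₁ * (e₁ + α w))             ≈⟨ *-congˡ (*-congˡ (+-comm e₁ (α w))) ⟩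
    v * v * (e₁ * (α w + e₁))             ≈⟨ *-congˡ (norm-at-root-of-R norm) ⟨
    v * v * - (q₀ w * q₁ w)               ≈⟨ -‿distribʳ-* _ _ ⟨
    - (v * v * (q₀ w * q₁ w))             ≈⟨ -‿cong (interchange v v _ _) ⟩
    - ((v * q₀ w) * (v * q₁ w))           ≈⟨ -‿cong (*-cong (lin-swap v w V₀ W₀) (lin-swap v w V₁ W₁)) ⟩
    - (- (V₀ * ρ W₀) * - (V₁ * ρ W₁))     ≈⟨ -‿cong (-x*-y≈x*y _ _) ⟩
    - ((V₀ * ρ W₀) * (V₁ * ρ W₁))         ≈⟨ -‿cong (interchange V₀ _ V₁ _) ⟩
    - ((V₀ * V₁) * (ρ W₀ * ρ W₁))         ≈⟨ -‿distribˡ-* _ _ ⟩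
    - (V₀ * V₁) * (ρ W₀ * ρ W₁)           ≈⟨ *-cong leading (*-cong ρ₀ ρ₁) ⟩
    e₁ * ((e₁ * - e₀) * (e₁ * - e₂))      ≈⟨ *-congˡ (interchange e₁ _ e₁ _) ⟩
    e₁ * ((e₁ * e₁) * (- e₀ * - e₂))      ≈⟨ *-congˡ (*-congˡ (-x*-y≈x*y e₀ e₂)) ⟩
    e₁ * ((e₁ * e₁) * (e₀ * e₂))          ≈⟨ *-congˡ (x∙yz≈yx∙z _ e₀ e₂) ⟩
    e₁ * (e₀ * (e₁ * e₁) * e₂)            ∎)
    where
    α ρ q₀ q₁ : Carrier → Carrier
    α = eval A
    ρ = eval R
    q₀ = eval (lin V₀ W₀)
    q₁ = eval (lin V₁ W₁)

    -x*-y≈x*y : ∀ x y → - x * - y ≈ x * y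
    -x*-y≈x*y x y = begin
      - x * - y      ≈⟨ -‿distribˡ-* x (- y) ⟨
      - (x * - y)    ≈⟨ -‿cong (-‿distribʳ-* x y) ⟨
      - - (x * y)    ≈⟨ -‿involutive _ ⟩
      x * y          ∎

    complement : ∀ {x y z} → x + y + z ≈ 0# → z + y ≈ - x
    complement {x} {y} {z} x+y+z≈0 =
      +-inverseʳ-unique x _ (trans (+-congˡ (+-comm z y)) (trans (sym (+-assoc x y z)) x+y+z≈0))

    ρ₀ : ρ W₀ ≈ e₁ * - e₀
    ρ₀ = begin
      ρ W₀               ≈⟨ norm-where-product-vanishes norm (trans (*-congʳ (lin-root V₀ W₀)) (zeroˡ _)) ⟩
      e₁ * (α W₀ + e₁)   ≈⟨ *-congˡ (complement (sum-at-root sum₀)) ⟩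
      e₁ * - e₀          ∎

    ρ₁ : ρ W₁ ≈ e₁ * - e₂
    ρ₁ = begin
      ρ W₁               ≈⟨ norm-where-product-vanishes norm (trans (*-congˡ (lin-root V₁ W₁)) (zeroʳ _)) ⟩
      e₁ * (α W₁ + e₁)   ≈⟨ *-congˡ (complement (trans (+-congʳ (+-comm e₂ e₁)) (sum-at-root sum₁))) ⟩
      e₁ * - e₂          ∎

module MonicQuadraticRecurrence {c ℓ} (K : CommutativeRing c ℓ) (a₀ a₁ v w : CommutativeRing.Carrier K) where
  open CommutativeRing K
  open Poly K
  open RingProperties ring using (-1*x≈-x)
  open Recurrence K (monicQuad a₀ a₁) v w public
  open import Relation.Binary.Reasoning.Setoid setoid

  norm-leading : ∀ {V W V′ W′ e} → NormRelation (lin V W) (lin V′ W′) e → - (V * V′) ≈ e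
  norm-leading {V} {W} {V′} {W′} {e} (norm-relation rel) = begin
    - (V * V′)       ≈⟨ -1*x≈-x _ ⟨
    - 1# * (V * V′)  ≈⟨ rel 2 ⟩  -- the X² coefficients
    e * 1#           ≈⟨ *-identityʳ e ⟩
    e                ∎

module FieldProperties {c ℓ} {K : CommutativeRing c ℓ} (isField : IsFieldCR K) where
  open CommutativeRing K
  open IsFieldCR isField
  open RingProperties ring using (-0#≈0#; -‿injective)
  open CommutativeSemigroupProperties *-commutativeSemigroup using (xy∙z≈y∙xz)
  open import Relation.Binary.Reasoning.Setoid setoid

  *-cancelˡ-≉0 : ∀ {x y z} → x ≉ 0# → x * y ≈ x * z → y ≈ z
  *-cancelˡ-≉0 {x} {y} {z} x≉0 xy≈xz with inverse x x≉0
  ... | x⁻¹ , xx⁻¹≈1 = begin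
    y              ≈⟨ *-identityˡ y ⟨
    1# * y         ≈⟨ *-congʳ xx⁻¹≈1 ⟨
    (x * x⁻¹) * y  ≈⟨ xy∙z≈y∙xz x x⁻¹ y ⟩
    x⁻¹ * (x * y)  ≈⟨ *-congˡ xy≈xz ⟩
    x⁻¹ * (x * z)  ≈⟨ xy∙z≈y∙xz x x⁻¹ z ⟨
    (x * x⁻¹) * z  ≈⟨ *-congʳ xx⁻¹≈1 ⟩
    1# * z         ≈⟨ *-identityˡ z ⟩
    z              ∎

  *-≉0 : ∀ {x y} → x ≉ 0# → y ≉ 0# → x * y ≉ 0#
  *-≉0 x≉0 y≉0 xy≈0 = y≉0 (*-cancelˡ-≉0 x≉0 (trans xy≈0 (sym (zeroʳ _))))

  -‿≉0 : ∀ {x} → x ≉ 0# → - x ≉ 0#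
  -‿≉0 x≉0 -x≈0 = x≉0 (-‿injective (trans -x≈0 (sym -0#≈0#)))

mainTheorem1 : ∀ {c ℓ} (K : CommutativeRing c ℓ) → IsFieldCR K →
    let open CommutativeRing K in
    let open Poly K in
    (a₀ a₁ : Carrier) → (v w : Carrier) → ¬ (v ≈ 0#) →
    (e : ℤ → Carrier) → (vs ws : ℤ → Carrier) → (a : ℤ → Pol) → (h : ℤ) →
    ¬ (vs (Z.pred h) ≈ 0#) → ¬ (vs h ≈ 0#) → ¬ (vs (Z.suc h) ≈ 0#) →
    (∀ j → (j ≡ Z.pred h ⊎ j ≡ h) →
      ((C (e j) +ₚ C (e (Z.suc j)) +ₚ monicQuad a₀ a₁)
          ≈ₚ (a j *ₚ lin (vs j) (ws j)))
      × ((-ₚ (lin (vs j) (ws j) *ₚ lin (vs (Z.suc j)) (ws (Z.suc j))))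
          ≈ₚ ((-ₚ lin v w) +ₚ (C (e (Z.suc j)) *ₚ (monicQuad a₀ a₁ +ₚ C (e (Z.suc j))))))) →
    (e (Z.pred h) * (e h * e h) * e (Z.suc h))
      ≈ ((v * v) * (e h + eval (monicQuad a₀ a₁) w))
-- The hypotheses v ≠ 0 and v_{h+1} ≠ 0, and the norm relation at index h, are not needed.
mainTheorem1 K isField a₀ a₁ v w _ e vs ws a h vₕ₋₁≉0 vₕ≉0 _ relations =
  *-cancelˡ-≉0 eₕ≉0 (e-relation-up-to-e₁ sumₕ₋₁ sumₕ normₕ₋₁ leading)
  where
  open CommutativeRing K
  open Poly K
  open MonicQuadraticRecurrence K a₀ a₁ v w
  open FieldProperties isField

  g : ℤ
  g = Z.pred h

  Q : ℤ → Pol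
  Q j = lin (vs j) (ws j)

  sumₕ₋₁ : SumRelation (e g) (e h) (Q g) (a g)
  sumₕ₋₁ = ≡.subst (λ k → SumRelation (e g) (e k) (Q g) (a g)) (suc-pred h)
    (sum-relation (proj₁ (relations g (inj₁ ≡.refl))))

  sumₕ : SumRelation (e h) (e (Z.suc h)) (Q h) (a h)
  sumₕ = sum-relation (proj₁ (relations h (inj₂ ≡.refl)))

  normₕ₋₁ : NormRelation (Q g) (Q h) (e h)
  normₕ₋₁ = ≡.subst (λ k → NormRelation (Q g) (Q k) (e k)) (suc-pred h)
    (norm-relation (proj₂ (relations g (inj₁ ≡.refl))))

  leading : - (vs g * vs h) ≈ e h
  leading = norm-leading normₕ₋₁

  eₕ≉0 : e h ≉ 0#
  eₕ≉0 eₕ≈0 = -‿≉0 (*-≉0 vₕ₋₁≉0 vₕ≉0) (trans leading eₕ≈0)
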